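{- Let $c\ge 2$ be an integer and let $D_c$ be the graph with vertex set $\{v,v_1,\dots,v_c\}\cup\{v_{i,j} : 1\le i<j\le c\}$ and edge set $\{vv_i : i\in[c]\}\cup\{v_iv_{i,j},\ v_jv_{i,j} : 1\le i<j\le c\}$. Then $D_c$ does not admit a good $(c-1)$-edge-labeling. More generally, for every good edge-labeling $\lambda$ of $D_c$ and every $i\ne j$ in $[c]$, $\lambda(vv_i)\ne\lambda(vv_j)$.
   Context: An edge-labeling of a graph $G$ is a function $\lambda:E(G)\to\mathbb{R}$; it is a $c$-edge-labeling if it takes at most $c$ distinct values. A path is increasing if the sequence of labels of its edges, read along the path, is non-decreasing. An edge-labeling is good if for every ordered pair of vertices $(x,y)$ there are no two distinct increasing paths from $x$ to $y$. -}

module Defs where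

open import Level using (Level; _⊔_) renaming (suc to lsuc)
open import Data.Nat using (ℕ; _≤_; _∸_)
open import Data.Fin using (Fin) renaming (_<_ to _<ᶠ_)
open import Data.Product using (_×_; _,_; ∃-syntax)
open import Data.Sum using (_⊎_)
open import Data.List using (List; []; _∷_; map; length)
open import Data.List.Membership.Propositional using (_∈_)
open import Data.List.Relation.Unary.Unique.Propositional using (Unique)
open import Data.List.Relation.Unary.Linked using (Linked)
open import Relation.Binary.PropositionalEquality using (_≡_)
open import Relation.Binary.Core using (Rel)

-- Finite-or-not (multi)graphs given by an edge type and endpoints.
-- Edges are undirected: an edge with ends (a , b) can be traversed
-- from a to b or from b to a.

record Graph : Set₁ where
  field
    V    : Set
    E    : Set
    ends : E → V × V

module _ (G : Graph) where
  open Graph G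

  Joins : E → V → V → Set
  Joins e x y = (ends e ≡ (x , y)) ⊎ (ends e ≡ (y , x))

  data Walk : V → V → Set where
    []  : ∀ {x} → Walk x x
    step : ∀ {x y z} (e : E) → Joins e x y → Walk y z → Walk x z

  edges : ∀ {x y} → Walk x y → List E
  edges []             = []
  edges (step e _ w)   = e ∷ edges w

  vertices : ∀ {x y} → Walk x y → List V
  vertices {x} []      = x ∷ []
  vertices {x} (step _ _ w) = x ∷ vertices w

  IsPath : ∀ {x y} → Walk x y → Set
  IsPath w = Unique (vertices w)

  module _ {a ℓ : Level} {L : Set a} (_≼_ : Rel L ℓ) (lab : E → L) where

    Increasing : ∀ {x y} → Walk x y → Set (a ⊔ ℓ)
    Increasing w = Linked _≼_ (map lab (edges w))

    -- good: for every ordered pair (x , y), any two increasing paths from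
    -- x to y coincide (distinct paths = distinct edge sequences).
    Good : Set (a ⊔ ℓ)
    Good = ∀ x y (p q : Walk x y) → IsPath p → IsPath q →
           Increasing p → Increasing q → edges p ≡ edges q

  AtMostValues : ∀ {a} {L : Set a} → (E → L) → ℕ → Set a
  AtMostValues {L = L} lab k =
    ∃[ vs ] (length vs ≤ k × (∀ e → lab e ∈ vs))

data DV (c : ℕ) : Set where
  cen  : DV c
  leaf : Fin c → DV c
  mid  : (i j : Fin c) → i <ᶠ j → DV c

data DE (c : ℕ) : Set where
  hub : Fin c → DE c
  lft : (i j : Fin c) → i <ᶠ j → DE c
  rgt : (i j : Fin c) → i <ᶠ j → DE c

D-ends : (c : ℕ) → DE c → DV c × DV c
D-ends c (hub i)       = cen , leaf i
D-ends c (lft i j i<j) = leaf i , mid i j i<j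
D-ends c (rgt i j i<j) = leaf j , mid i j i<j

D : ℕ → Graph
D c = record { V = DV c ; E = DE c ; ends = D-ends c }

{-# OPTIONS --safe #-}
module Submission where

-- If λ(vv_i) = λ(vv_j) for i < j, compare the labels of the two edges at v_{i,j}. If
-- λ(v_i v_{i,j}) ≤ λ(v_j v_{i,j}), then v_i v v_j and v_i v_{i,j} v_j are two distinct
-- increasing paths from v_i to v_j; otherwise the reversed paths go from v_j to v_i.
-- So the c hub edges carry c distinct labels, and c − 1 values are too few by pigeonhole.

open import Defs
open import Level using (Level)
open import Function using (_∘_)
open import Data.Nat using (ℕ; _≤_; _<_; _∸_; z≤n; s≤s; z<s)
open import Data.Nat.Properties using (≤-trans; ≤-<-trans; ∸-monoʳ-<)
open import Data.Fin using (Fin) renaming (_<_ to _<ᶠ_)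
open import Data.Fin.Properties using (<-cmp; <⇒≢; pigeonhole)
open import Data.Product using (_×_; _,_; ∃₂)
open import Data.Sum using (inj₁; inj₂)
open import Data.List using (List; []; _∷_; length; lookup)
open import Data.List.Properties using (∷-injectiveˡ)
open import Data.List.Membership.Propositional using (_∈_)
open import Data.List.Relation.Unary.Any using (index)
open import Data.List.Relation.Unary.Any.Properties using (lookup-index)
open import Data.List.Relation.Unary.AllPairs using ([]; _∷_)
open import Data.List.Relation.Unary.All using ([]; _∷_)
open import Data.List.Relation.Unary.Linked using ([-]; _∷_)
open import Data.List.Relation.Unary.Unique.Propositional using (Unique)
open import Relation.Nullary using (¬_)
open import Relation.Binary.Core using (Rel)
open import Relation.Binary.Structures using (IsTotalOrder)
open import Relation.Binary.Definitions using (tri<; tri≈; tri>)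
open import Relation.Binary.PropositionalEquality using (_≡_; refl; sym; cong; ≢-sym; module ≡-Reasoning)

∈-pigeonhole : ∀ {a} {A : Set a} {n} (f : Fin n → A) {vs : List A} →
               length vs < n → (∀ i → f i ∈ vs) →
               ∃₂ λ i j → i <ᶠ j × f i ≡ f j
∈-pigeonhole f {vs} |vs|<n f∈vs with pigeonhole |vs|<n (index ∘ f∈vs)
... | i , j , i<j , same-index = i , j , i<j , f-same
  where
  open ≡-Reasoning
  f-same : f i ≡ f j
  f-same = begin
    f i                          ≡⟨ lookup-index (f∈vs i) ⟩
    lookup vs (index (f∈vs i))   ≡⟨ cong (lookup vs) same-index ⟩
    lookup vs (index (f∈vs j))   ≡⟨ sym (lookup-index (f∈vs j)) ⟩
    f j                          ∎

module _ (G : Graph) {a ℓ : Level} {L : Set a} {_≼_ : Rel L ℓ} {lab : Graph.E G → L}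
         (good : Good G _≼_ lab) where

  increasing-2-paths-share-first-edge :
    ∀ {x y y′ z e f e′ f′} →
    Unique (x ∷ y ∷ z ∷ []) → Unique (x ∷ y′ ∷ z ∷ []) →
    (exy : Joins G e x y) (fyz : Joins G f y z) (e′xy′ : Joins G e′ x y′) (f′y′z : Joins G f′ y′ z) →
    lab e ≼ lab f → lab e′ ≼ lab f′ → e ≡ e′
  increasing-2-paths-share-first-edge {x} {z = z} xyz xy′z exy fyz e′xy′ f′y′z e≼f e′≼f′ =
    ∷-injectiveˡ (good x z (step _ exy (step _ fyz [])) (step _ e′xy′ (step _ f′y′z []))
                         xyz xy′z (e≼f ∷ [-]) (e′≼f′ ∷ [-]))

module _ {c : ℕ} {a ℓ : Level} {L : Set a} {_≼_ : Rel L ℓ} (total-order : IsTotalOrder _≡_ _≼_)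
         {lab : DE c → L} (good : Good (D c) _≼_ lab) where
  open IsTotalOrder total-order using (reflexive; total)

  leaf-injective : ∀ {i j : Fin c} → leaf {c} i ≡ leaf j → i ≡ j
  leaf-injective refl = refl

  detour-unique : ∀ {i j : Fin c} {u : DV c} → ¬ i ≡ j → (∀ k → ¬ leaf k ≡ u) →
                  Unique (leaf i ∷ u ∷ leaf j ∷ [])
  detour-unique i≢j leaf≢u =
    (leaf≢u _ ∷ (i≢j ∘ leaf-injective) ∷ []) ∷ (≢-sym (leaf≢u _) ∷ []) ∷ [] ∷ []

  hub-labels-distinct-< : ∀ {i j : Fin c} → i <ᶠ j → ¬ lab (hub i) ≡ lab (hub j)
  hub-labels-distinct-< {i} {j} i<j same with total (lab (lft i j i<j)) (lab (rgt i j i<j))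
  ... | inj₁ lft≼rgt
    with increasing-2-paths-share-first-edge (D c) good
           (detour-unique i≢j λ _ ()) (detour-unique i≢j λ _ ())
           (inj₂ refl) (inj₁ refl) (inj₁ refl) (inj₂ refl) (reflexive same) lft≼rgt
    where i≢j = <⇒≢ i<j
  ... | ()
  hub-labels-distinct-< {i} {j} i<j same | inj₂ rgt≼lft
    with increasing-2-paths-share-first-edge (D c) good
           (detour-unique j≢i λ _ ()) (detour-unique j≢i λ _ ())
           (inj₂ refl) (inj₁ refl) (inj₁ refl) (inj₂ refl) (reflexive (sym same)) rgt≼lft
    where j≢i = ≢-sym (<⇒≢ i<j)
  ... | ()

  hub-labels-distinct : ∀ (i j : Fin c) → ¬ i ≡ j → ¬ lab (hub i) ≡ lab (hub j)
  hub-labels-distinct i j i≢j with <-cmp i j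
  ... | tri< i<j _ _ = hub-labels-distinct-< i<j
  ... | tri≈ _ i≡j _ = λ _ → i≢j i≡j
  ... | tri> _ _ j<i = hub-labels-distinct-< j<i ∘ sym

mainTheorem13 : ∀ {a ℓ : Level} (c : ℕ) → 2 ≤ c →
    (L : Set a) (_≼_ : Rel L ℓ) → IsTotalOrder _≡_ _≼_ →
    (∀ (lab : DE c → L) → Good (D c) _≼_ lab →
       ¬ AtMostValues (D c) lab (c ∸ 1))
    × (∀ (lab : DE c → L) → Good (D c) _≼_ lab →
       ∀ (i j : Fin c) → ¬ i ≡ j → ¬ lab (hub i) ≡ lab (hub j))
mainTheorem13 c 2≤c L _≼_ total-order = too-few-values , λ lab → hub-labels-distinct total-order
  where
  c∸1<c : c ∸ 1 < c
  c∸1<c = ∸-monoʳ-< z<s (≤-trans (s≤s z≤n) 2≤c)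

  too-few-values : ∀ (lab : DE c → L) → Good (D c) _≼_ lab → ¬ AtMostValues (D c) lab (c ∸ 1)
  too-few-values lab good (vs , |vs|≤c∸1 , lab∈vs)
    with ∈-pigeonhole (lab ∘ hub) (≤-<-trans |vs|≤c∸1 c∸1<c) (lab∈vs ∘ hub)
  ... | i , j , i<j , same = hub-labels-distinct-< total-order good i<j same
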